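{- Let $b\ge2$ be an integer, $\mathcal{D}=\{0,1,\dots,b-1\}$, and let $E\subseteq\mathcal{D}$ have cardinality $p$ with $1\le p<b$. Then $K(b,E)\le K(b,\{0,b-1,b-2,\dots,b-p+1\})$, with equality only if $E=\{0,b-1,\dots,b-p+1\}$.
   Context: $K(b,E)$ denotes the sum of $1/m$ over all positive integers $m$ none of whose base-$b$ digits lies in $E$. For $p=1$ the set $\{0,b-1,\dots,b-p+1\}$ is $\{0\}$. -}

module Defs where

open import Data.Nat as ℕ using (ℕ; zero; suc; _<_; _+_; _≟_)
open import Data.Nat.DivMod using (_%_; _/_; m%n<n)
open import Data.Integer using (+_)
open import Data.Rational as ℚ using (ℚ; 0ℚ; Positive)
open import Data.Bool using (Bool; true; false; if_then_else_; _∨_; not)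
open import Data.Fin using (Fin; toℕ; fromℕ<)
open import Data.Fin.Subset using (Subset)
open import Data.Vec using (lookup; tabulate)
open import Data.Product using (∃)
open import Relation.Nullary.Decidable using (⌊_⌋)

-- hasDigitIn b E fuel m : does some base-b digit of m lie in E?
-- (digits of m are m % b, (m / b) % b, ... until the quotient is 0;
--  fuel m suffices since b ≥ 2; m = 0 has no digits here, it is never used)
hasDigitIn : (b : ℕ) → Subset b → ℕ → ℕ → Bool
hasDigitIn zero    E fuel       m       = false
hasDigitIn (suc c) E zero       m       = false
hasDigitIn (suc c) E (suc fuel) zero    = false
hasDigitIn (suc c) E (suc fuel) (suc k) =
  lookup E (fromℕ< (m%n<n (suc k) (suc c)))
  ∨ hasDigitIn (suc c) E fuel (suc k / suc c)

avoids : (b : ℕ) → Subset b → ℕ → Bool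
avoids b E m = not (hasDigitIn b E m m)

K : (b : ℕ) → Subset b → ℕ → ℚ
K b E zero    = 0ℚ
K b E (suc n) = K b E n ℚ.+ (if avoids b E (suc n) then (+ 1 ℚ./ suc n) else 0ℚ)

-- For nondecreasing sequences s, t of rationals: sup s ≤ sup t
-- (as extended reals), i.e. every s n is ≤ sup t.
SupLe : (ℕ → ℚ) → (ℕ → ℚ) → Set
SupLe s t = ∀ (n : ℕ) (ε : ℚ) → Positive ε → ∃ λ M → s n ℚ.≤ t M ℚ.+ ε

-- The set {0, b-1, b-2, ..., b-p+1} ⊆ {0,...,b-1}:  i with i = 0 or b < i + p
special : (b p : ℕ) → Subset b
special b p = tabulate λ i → ⌊ toℕ i ≟ 0 ⌋ ∨ ⌊ b ℕ.<? toℕ i + p ⌋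

module Submission where

-- Let q = b - p. Replacing each digit of m by its rank among the allowed digits (those outside E) and
-- rewriting the resulting base-q numeral with the digits 1, …, q in base b maps the m avoiding E
-- injectively to numbers shrink m ≤ m avoiding {0, q + 1, …, b - 1}; comparing 1/m ≤ 1/shrink m term by
-- term gives the inequality. If E is not the special set, some m₀ has shrink m₀ < m₀ (or no positive m
-- avoids E at all), so the partial sums for the special set eventually exceed those for E by a fixed
-- amount; as the former are bounded (by b²), the suprema cannot then be in the reverse order.

open import Data.Nat as ℕ using (ℕ; zero; suc)
import Data.Nat.Properties as ℕ
import Data.Nat.Coprimality as Coprime
import Data.Integer as ℤ
import Data.Integer.Properties as ℤP
import Data.Rational as ℚ
import Data.Rational.Properties as ℚ
open import Data.Bool using (Bool; true; not)
open import Data.Fin.Subset using (Subset; ∣_∣)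
open import Defs
open import Relation.Binary.PropositionalEquality

module Reciprocals where

  open import Data.Rational using (ℚ; 0ℚ; 1ℚ; mkℚ; _≤_; _<_; _+_; _*_)
  open import Data.Rational.Properties using (≤-refl; +-monoˡ-≤; +-monoʳ-≤; +-assoc; +-identityʳ)
  open import Data.Rational.Solver using (module +-*-Solver)
  open +-*-Solver using (solve; _:=_; _:+_; _:*_; con)

  open ≡-Reasoning

  fromℕ : ℕ → ℚ
  fromℕ n = mkℚ (ℤ.+ n) 0 (Coprime.sym (Coprime.1-coprimeTo n))

  -- recip 0 = 0 is a junk value, so the term m = 0 contributes nothing to the partial sums.
  recip : ℕ → ℚ
  recip zero    = 0ℚ
  recip (suc k) = ℤ.+ 1 ℚ./ suc k

  recip-mkℚ : ∀ k → recip (suc k) ≡ mkℚ (ℤ.+ 1) k (Coprime.1-coprimeTo (suc k))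
  recip-mkℚ k = ℚ.normalize-coprime (Coprime.1-coprimeTo (suc k))

  fromℕ-suc : ∀ n → fromℕ (suc n) ≡ 1ℚ + fromℕ n
  fromℕ-suc n = sym (begin
    1ℚ + fromℕ n           ≡⟨ cong (λ z → (ℤ.+ 1 ℤ.+ z) ℚ./ 1) (ℤP.*-identityʳ (ℤ.+ n)) ⟩
    ℤ.+ suc n ℚ./ 1          ≡⟨ ℚ.normalize-coprime (Coprime.sym (Coprime.1-coprimeTo (suc n))) ⟩
    fromℕ (suc n)          ∎)

  fromℕ-+ : ∀ m n → fromℕ (m ℕ.+ n) ≡ fromℕ m + fromℕ n
  fromℕ-+ zero    n = sym (ℚ.+-identityˡ (fromℕ n))
  fromℕ-+ (suc m) n = begin
    fromℕ (suc (m ℕ.+ n))     ≡⟨ fromℕ-suc (m ℕ.+ n) ⟩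
    1ℚ + fromℕ (m ℕ.+ n)      ≡⟨ cong (λ v → 1ℚ + v) (fromℕ-+ m n) ⟩
    1ℚ + (fromℕ m + fromℕ n)  ≡⟨ sym (+-assoc 1ℚ (fromℕ m) (fromℕ n)) ⟩
    (1ℚ + fromℕ m) + fromℕ n  ≡⟨ cong (_+ fromℕ n) (sym (fromℕ-suc m)) ⟩
    fromℕ (suc m) + fromℕ n   ∎

  fromℕ-* : ∀ m n → fromℕ (m ℕ.* n) ≡ fromℕ m * fromℕ n
  fromℕ-* zero    n = sym (ℚ.*-zeroˡ (fromℕ n))
  fromℕ-* (suc m) n = begin
    fromℕ (n ℕ.+ m ℕ.* n)          ≡⟨ fromℕ-+ n (m ℕ.* n) ⟩
    fromℕ n + fromℕ (m ℕ.* n)      ≡⟨ cong (λ v → fromℕ n + v) (fromℕ-* m n) ⟩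
    fromℕ n + fromℕ m * fromℕ n    ≡⟨ solve 2 (λ x y → y :+ x :* y := (con 1ℚ :+ x) :* y) refl (fromℕ m) (fromℕ n) ⟩
    (1ℚ + fromℕ m) * fromℕ n       ≡⟨ cong (_* fromℕ n) (sym (fromℕ-suc m)) ⟩
    fromℕ (suc m) * fromℕ n        ∎

  fromℕ-nonNeg : ∀ n → 0ℚ ≤ fromℕ n
  fromℕ-nonNeg n = ℚ.nonNegative⁻¹ (fromℕ n)

  recip-nonNeg : ∀ n → 0ℚ ≤ recip n
  recip-nonNeg zero    = ≤-refl
  recip-nonNeg (suc k) rewrite recip-mkℚ k = ℚ.nonNegative⁻¹ _

  recip-pos : ∀ k → 0ℚ < recip (suc k)
  recip-pos k rewrite recip-mkℚ k = ℚ.positive⁻¹ _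

  fromℕ*recip≡1 : ∀ k → fromℕ (suc k) * recip (suc k) ≡ 1ℚ
  fromℕ*recip≡1 k = trans (cong (λ v → fromℕ (suc k) * v) (recip-mkℚ k)) (ℚ.*-inverseʳ (fromℕ (suc k)))

  *-monoˡ-≤-nonNeg : ∀ r → 0ℚ ≤ r → ∀ {p q} → p ≤ q → r * p ≤ r * q
  *-monoˡ-≤-nonNeg r 0≤r = ℚ.*-monoˡ-≤-nonNeg r {{ℚ.nonNegative 0≤r}}

  *-monoʳ-≤-nonNeg : ∀ r → 0ℚ ≤ r → ∀ {p q} → p ≤ q → p * r ≤ q * r
  *-monoʳ-≤-nonNeg r 0≤r = ℚ.*-monoʳ-≤-nonNeg r {{ℚ.nonNegative 0≤r}}

  p≤p+q : ∀ p {q} → 0ℚ ≤ q → p ≤ p + q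
  p≤p+q p 0≤q = subst (_≤ p + _) (+-identityʳ p) (+-monoʳ-≤ p 0≤q)

  +-cancelʳ-≤ : ∀ p q r → p + r ≤ q + r → p ≤ q
  +-cancelʳ-≤ p q r p+r≤q+r = subst₂ _≤_ (cancel p) (cancel q) (+-monoˡ-≤ (ℚ.- r) p+r≤q+r)
    where
    cancel : ∀ x → (x + r) + ℚ.- r ≡ x
    cancel x = trans (+-assoc x r (ℚ.- r)) (trans (cong (λ v → x + v) (ℚ.+-inverseʳ r)) (+-identityʳ x))

  fromℕ-mono-≤ : ∀ {m n} → m ℕ.≤ n → fromℕ m ≤ fromℕ n
  fromℕ-mono-≤ {m} {n} m≤n =
    subst (fromℕ m ≤_) (trans (sym (fromℕ-+ m (n ℕ.∸ m))) (cong fromℕ (ℕ.m+[n∸m]≡n m≤n)))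
      (p≤p+q (fromℕ m) (fromℕ-nonNeg (n ℕ.∸ m)))

  fromℕ*recip[*]≡recip : ∀ a c → fromℕ (suc a) * recip (suc a ℕ.* c) ≡ recip c
  fromℕ*recip[*]≡recip a zero rewrite ℕ.*-zeroʳ a = ℚ.*-zeroʳ (fromℕ (suc a))
  fromℕ*recip[*]≡recip a (suc c) = begin
    x * y                    ≡⟨ sym (ℚ.*-identityʳ (x * y)) ⟩
    (x * y) * 1ℚ             ≡⟨ cong (λ v → (x * y) * v) (sym (fromℕ*recip≡1 c)) ⟩
    (x * y) * (z * t)        ≡⟨ solve 4 (λ x y z t → (x :* y) :* (z :* t) := ((x :* z) :* y) :* t) refl x y z t ⟩
    ((x * z) * y) * t        ≡⟨ cong (λ v → (v * y) * t) (sym (fromℕ-* (suc a) (suc c))) ⟩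
    (fromℕ (suc a ℕ.* suc c) * y) * t ≡⟨ cong (_* t) (fromℕ*recip≡1 (c ℕ.+ a ℕ.* suc c)) ⟩
    1ℚ * t                   ≡⟨ ℚ.*-identityˡ t ⟩
    recip (suc c)            ∎
    where
    x = fromℕ (suc a)
    y = recip (suc a ℕ.* suc c)
    z = fromℕ (suc c)
    t = recip (suc c)

  -- 1/(b+1) = (a+1)/((a+1)(b+1)), so both sides of the comparisons below share the denominator (a+1)(b+1).
  private
    recip-as-fraction : ∀ a b → fromℕ (suc a) * recip (suc b ℕ.* suc a) ≡ recip (suc b)
    recip-as-fraction a b = trans (cong (λ v → fromℕ (suc a) * recip v) (ℕ.*-comm (suc b) (suc a)))
                                  (fromℕ*recip[*]≡recip a (suc b))

  recip-antimono : ∀ {a b} → a ℕ.≤ b → recip (suc b) ≤ recip (suc a)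
  recip-antimono {a} {b} a≤b =
    subst₂ _≤_ (recip-as-fraction a b) (fromℕ*recip[*]≡recip b (suc a))
      (*-monoʳ-≤-nonNeg _ (recip-nonNeg (suc b ℕ.* suc a)) (fromℕ-mono-≤ (ℕ.s≤s a≤b)))

  recip≤1 : ∀ n → recip n ≤ 1ℚ
  recip≤1 zero    = ℚ.nonNegative⁻¹ 1ℚ
  recip≤1 (suc k) = recip-antimono {b = k} ℕ.z≤n

  recip+recip[*]≤recip : ∀ {a b} → a ℕ.< b → recip (suc b) + recip (suc a ℕ.* suc b) ≤ recip (suc a)
  recip+recip[*]≤recip {a} {b} a<b =
    subst₂ _≤_ split (fromℕ*recip[*]≡recip b (suc a))
      (*-monoʳ-≤-nonNeg W (recip-nonNeg (suc b ℕ.* suc a)) a+2≤b+1)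
    where
    W = recip (suc b ℕ.* suc a)
    a+2≤b+1 : fromℕ (suc a) + 1ℚ ≤ fromℕ (suc b)
    a+2≤b+1 = subst (_≤ fromℕ (suc b)) (fromℕ-+ (suc a) 1)
                (fromℕ-mono-≤ (subst (ℕ._≤ suc b) (ℕ.+-comm 1 (suc a)) (ℕ.s≤s a<b)))
    split : (fromℕ (suc a) + 1ℚ) * W ≡ recip (suc b) + recip (suc a ℕ.* suc b)
    split = begin
      (fromℕ (suc a) + 1ℚ) * W       ≡⟨ ℚ.*-distribʳ-+ W (fromℕ (suc a)) 1ℚ ⟩
      fromℕ (suc a) * W + 1ℚ * W     ≡⟨ cong₂ _+_ (recip-as-fraction a b)
                                          (trans (ℚ.*-identityˡ W) (cong recip (ℕ.*-comm (suc b) (suc a)))) ⟩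
      recip (suc b) + recip (suc a ℕ.* suc b) ∎

  recip≡half+half : ∀ n → recip (suc n) ≡ recip (2 ℕ.* suc n) + recip (2 ℕ.* suc n)
  recip≡half+half n = trans (sym (fromℕ*recip[*]≡recip 1 (suc n)))
    (solve 1 (λ x → (con 1ℚ :+ con 1ℚ) :* x := x :+ x) refl (recip (2 ℕ.* suc n)))

module FiniteSums where

  open import Data.Rational using (ℚ; 0ℚ; 1ℚ; _≤_; _+_; _*_)
  open import Data.Rational.Properties using (≤-refl; ≤-trans; +-mono-≤; +-monoˡ-≤; +-assoc; +-identityʳ)
  open import Data.Rational.Solver using (module +-*-Solver)
  open +-*-Solver using (solve; _:=_; _:+_; _:*_; con)

  open import Data.Bool using (Bool; true; false; if_then_else_; _∧_; not)
  open import Data.Empty using (⊥-elim)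
  open import Data.Sum using (inj₁; inj₂)
  open import Data.Bool.Properties using (T-≡)
  open import Function.Bundles using (Equivalence)
  open Reciprocals
  open ≡-Reasoning

  sumBelow : (ℕ → ℚ) → ℕ → ℚ
  sumBelow g zero    = 0ℚ
  sumBelow g (suc n) = sumBelow g n + g n

  sumBelow-mono : ∀ {u v : ℕ → ℚ} N → (∀ m → m ℕ.< N → u m ≤ v m) → sumBelow u N ≤ sumBelow v N
  sumBelow-mono zero    u≤v = ≤-refl
  sumBelow-mono (suc N) u≤v = +-mono-≤ (sumBelow-mono N (λ m m<N → u≤v m (ℕ.m≤n⇒m≤1+n m<N))) (u≤v N ℕ.≤-refl)

  sumBelow-nonNeg : ∀ {u : ℕ → ℚ} → (∀ m → 0ℚ ≤ u m) → ∀ N → 0ℚ ≤ sumBelow u N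
  sumBelow-nonNeg u≥0 zero    = ≤-refl
  sumBelow-nonNeg u≥0 (suc N) = +-mono-≤ (sumBelow-nonNeg u≥0 N) (u≥0 N)

  sumBelow-monoʳ : ∀ {u : ℕ → ℚ} → (∀ m → 0ℚ ≤ u m) → ∀ {M N} → M ℕ.≤ N → sumBelow u M ≤ sumBelow u N
  sumBelow-monoʳ u≥0 {M} {zero}  ℕ.z≤n = ≤-refl
  sumBelow-monoʳ {u} u≥0 {M} {suc N} M≤1+N with ℕ.m≤n⇒m<n∨m≡n M≤1+N
  ... | inj₁ (ℕ.s≤s M≤N) = ≤-trans (sumBelow-monoʳ u≥0 M≤N) (p≤p+q (sumBelow u N) (u≥0 N))
  ... | inj₂ refl       = ≤-refl

  sumBelow-strict : ∀ {u v : ℕ → ℚ} → (∀ m → u m ≤ v m) → ∀ {m₀ δ} → u m₀ + δ ≤ v m₀ →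
                    ∀ N → m₀ ℕ.< N → sumBelow u N + δ ≤ sumBelow v N
  sumBelow-strict {u} {v} u≤v {m₀} {δ} gap (suc N) (ℕ.s≤s m₀≤N) with ℕ.m≤n⇒m<n∨m≡n m₀≤N
  ... | inj₁ m₀<N = subst (_≤ sumBelow v (suc N))
                      (solve 3 (λ a x d → (a :+ d) :+ x := (a :+ x) :+ d) refl (sumBelow u N) (u N) δ)
                      (+-mono-≤ (sumBelow-strict u≤v gap N m₀<N) (u≤v N))
  ... | inj₂ refl = subst (_≤ sumBelow v (suc N)) (sym (+-assoc (sumBelow u N) (u N) δ))
                      (+-mono-≤ (sumBelow-mono N (λ m _ → u≤v m)) gap)

  sumBelow≤fromℕ : ∀ {u : ℕ → ℚ} → (∀ m → u m ≤ 1ℚ) → ∀ N → sumBelow u N ≤ fromℕ N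
  sumBelow≤fromℕ u≤1 zero    = ≤-refl
  sumBelow≤fromℕ {u} u≤1 (suc N) = subst (sumBelow u (suc N) ≤_) (trans (ℚ.+-comm (fromℕ N) 1ℚ) (sym (fromℕ-suc N)))
                                 (+-mono-≤ (sumBelow≤fromℕ u≤1 N) (u≤1 N))

  sumBelow-+ : ∀ (g : ℕ → ℚ) M N → sumBelow g (M ℕ.+ N) ≡ sumBelow g N + sumBelow (λ e → g (e ℕ.+ N)) M
  sumBelow-+ g zero    N = sym (+-identityʳ (sumBelow g N))
  sumBelow-+ g (suc M) N = trans (cong (_+ g (M ℕ.+ N)) (sumBelow-+ g M N)) (+-assoc (sumBelow g N) _ _)

  sumBelow-const : ∀ c N → sumBelow (λ _ → c) N ≡ fromℕ N * c
  sumBelow-const c zero    = sym (ℚ.*-zeroˡ c)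
  sumBelow-const c (suc N) = begin
    sumBelow (λ _ → c) N + c  ≡⟨ cong (_+ c) (sumBelow-const c N) ⟩
    fromℕ N * c + c           ≡⟨ solve 2 (λ x h → x :* h :+ h := (con 1ℚ :+ x) :* h) refl (fromℕ N) c ⟩
    (1ℚ + fromℕ N) * c        ≡⟨ cong (_* c) (sym (fromℕ-suc N)) ⟩
    fromℕ (suc N) * c         ∎

  sumBelow-suc : ∀ (g : ℕ → ℚ) N → sumBelow g (suc N) ≡ g 0 + sumBelow (λ e → g (suc e)) N
  sumBelow-suc g zero    = trans (ℚ.+-identityˡ (g 0)) (sym (+-identityʳ (g 0)))
  sumBelow-suc g (suc N) = trans (cong (_+ g (suc N)) (sumBelow-suc g N)) (+-assoc (g 0) _ _)

  restrict : (ℕ → Bool) → (ℕ → ℚ) → ℕ → ℚ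
  restrict X g m = if X m then g m else 0ℚ

  module _ (g : ℕ → ℚ) (g≥0 : ∀ m → 0ℚ ≤ g m) where

    restrict-nonNeg : ∀ X m → 0ℚ ≤ restrict X g m
    restrict-nonNeg X m with X m
    ... | true  = g≥0 m
    ... | false = ≤-refl

    restrict-≤ : ∀ X m → restrict X g m ≤ g m
    restrict-≤ X m with X m
    ... | true  = ≤-refl
    ... | false = g≥0 m

    restrict-mono : ∀ {X Y} → (∀ m → X m ≡ true → Y m ≡ true) → ∀ m → restrict X g m ≤ restrict Y g m
    restrict-mono {X} {Y} X⊆Y m with X m in Xm
    ... | false = restrict-nonNeg Y m
    ... | true rewrite X⊆Y m Xm = ≤-refl

    delete : (ℕ → Bool) → ℕ → ℕ → Bool
    delete Y y j = Y j ∧ not (j ℕ.≡ᵇ y)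

    delete⊆ : ∀ Y y m → delete Y y m ≡ true → Y m ≡ true
    delete⊆ Y y m with Y m
    ... | true  = λ _ → refl
    ... | false = λ ()

    sumBelow-delete : ∀ Y {y} → Y y ≡ true → ∀ N → y ℕ.< N →
                      sumBelow (restrict (delete Y y) g) N + g y ≤ sumBelow (restrict Y g) N
    sumBelow-delete Y {y} Yy N y<N = sumBelow-strict (restrict-mono (delete⊆ Y y)) gap N y<N
      where
      gap : restrict (delete Y y) g y + g y ≤ restrict Y g y
      gap rewrite Yy | Equivalence.to T-≡ (ℕ.≡⇒≡ᵇ y y refl) = ℚ.≤-reflexive (ℚ.+-identityˡ (g y))

    -- Induction on N: the last term g (f N) is paid for by deleting f N ≤ N from Y.
    sumBelow-reindex-≤ : ∀ (X : ℕ → Bool) (f : ℕ → ℕ) →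
      (∀ m → X m ≡ true → f m ℕ.≤ m) →
      (∀ m m′ → X m ≡ true → X m′ ≡ true → f m ≡ f m′ → m ≡ m′) →
      ∀ N Y → (∀ m → m ℕ.< N → X m ≡ true → Y (f m) ≡ true) →
      sumBelow (restrict X (λ m → g (f m))) N ≤ sumBelow (restrict Y g) N
    sumBelow-reindex-≤ X f f≤ f-inj zero    Y maps = ≤-refl
    sumBelow-reindex-≤ X f f≤ f-inj (suc N) Y maps with X N in XN
    ... | false = +-mono-≤ (sumBelow-reindex-≤ X f f≤ f-inj N Y (λ m m<N → maps m (ℕ.m≤n⇒m≤1+n m<N)))
                           (restrict-nonNeg Y N)
    ... | true  = ≤-trans (+-monoˡ-≤ (g (f N)) (≤-trans IH (p≤p+q _ (restrict-nonNeg Y′ N))))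
                          (sumBelow-delete Y (maps N ℕ.≤-refl XN) (suc N) (ℕ.s≤s (f≤ N XN)))
      where
      Y′ = delete Y (f N)
      maps′ : ∀ m → m ℕ.< N → X m ≡ true → Y′ (f m) ≡ true
      maps′ m m<N Xm rewrite maps m (ℕ.m≤n⇒m≤1+n m<N) Xm with f m ℕ.≡ᵇ f N in fm≡fN
      ... | false = refl
      ... | true  = ⊥-elim (ℕ.<-irrefl (f-inj m N Xm XN (ℕ.≡ᵇ⇒≡ _ _ (Equivalence.from T-≡ fm≡fN))) m<N)
      IH = sumBelow-reindex-≤ X f f≤ f-inj N Y′ maps′

module Suprema where

  open import Data.Rational using (ℚ; 0ℚ; 1ℚ; _≤_; _<_; _+_; _*_)
  open import Data.Rational.Properties using (≤-trans; +-monoˡ-≤; +-identityʳ)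
  open import Data.Rational.Solver using (module +-*-Solver)
  open +-*-Solver using (solve; _:=_; _:+_; _:*_; con)

  open import Relation.Nullary using (¬_)
  open import Data.Product using (_,_)
  open Reciprocals

  -- Play SupLe KS KE with ε = half the gap: each round, KS at the new index exceeds KS at the old one by ε,
  -- so after U/ε rounds KS would exceed its bound U.
  ¬SupLe-of-eventual-gap : (KE KS : ℕ → ℚ) (U : ℕ) → (∀ {M M′} → M ℕ.≤ M′ → KE M ≤ KE M′) →
    (∀ M → KS M ≤ fromℕ U) → 0ℚ ≤ KS 0 →
    ∀ n m₀ → (∀ M → m₀ ℕ.≤ M → KE M + recip (suc n) ≤ KS M) → ¬ SupLe KS KE
  ¬SupLe-of-eventual-gap KE KS U KE-mono KS≤U KS₀≥0 n m₀ gap sup = ℚ.<-irrefl refl (ℚ.<-≤-trans U<KS₀+j₀ε (rounds j₀ 0))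
    where
    den = 2 ℕ.* suc n
    ε = recip den
    ε>0 : 0ℚ < ε
    ε>0 = recip-pos (n ℕ.+ 1 ℕ.* suc n)

    rounds : ∀ j i → KS i + fromℕ j * ε ≤ fromℕ U
    rounds zero    i = subst (_≤ fromℕ U) (sym (trans (cong (KS i +_) (ℚ.*-zeroˡ ε)) (+-identityʳ (KS i)))) (KS≤U i)
    rounds (suc j) i with sup i ε (ℚ.positive ε>0)
    ... | M , KSi≤KEM+ε = ≤-trans climb (rounds j M′)
      where
      M′ = M ℕ.⊔ m₀
      KSi≤ : KS i ≤ KE M′ + ε
      KSi≤ = ≤-trans KSi≤KEM+ε (+-monoˡ-≤ ε (KE-mono (ℕ.m≤m⊔n M m₀)))
      gap′ : KE M′ + (ε + ε) ≤ KS M′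
      gap′ = subst (λ v → KE M′ + v ≤ KS M′) (recip≡half+half n) (gap M′ (ℕ.m≤n⊔m M m₀))
      climb : KS i + fromℕ (suc j) * ε ≤ KS M′ + fromℕ j * ε
      climb = begin
        KS i + fromℕ (suc j) * ε         ≡⟨ cong (λ v → KS i + v * ε) (fromℕ-suc j) ⟩
        KS i + (1ℚ + fromℕ j) * ε        ≤⟨ +-monoˡ-≤ _ KSi≤ ⟩
        (KE M′ + ε) + (1ℚ + fromℕ j) * ε ≡⟨ solve 4 (λ a e t u → (a :+ e) :+ (con 1ℚ :+ t) :* e
                                                     := (a :+ (e :+ e)) :+ t :* e) refl (KE M′) ε (fromℕ j) ε ⟩
        (KE M′ + (ε + ε)) + fromℕ j * ε  ≤⟨ +-monoˡ-≤ _ gap′ ⟩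
        KS M′ + fromℕ j * ε              ∎
        where open ℚ.≤-Reasoning

    j₀ = suc (U ℕ.* den)
    j₀ε≡ε+U : fromℕ j₀ * ε ≡ ε + fromℕ U
    j₀ε≡ε+U = begin
      fromℕ j₀ * ε                     ≡⟨ cong (_* ε) (trans (fromℕ-suc (U ℕ.* den)) (cong (1ℚ +_) (fromℕ-* U den))) ⟩
      (1ℚ + fromℕ U * fromℕ den) * ε   ≡⟨ solve 3 (λ u t e → (con 1ℚ :+ u :* t) :* e := e :+ u :* (t :* e))
                                            refl (fromℕ U) (fromℕ den) ε ⟩
      ε + fromℕ U * (fromℕ den * ε)    ≡⟨ cong (λ v → ε + fromℕ U * v) (fromℕ*recip≡1 (n ℕ.+ 1 ℕ.* suc n)) ⟩
      ε + fromℕ U * 1ℚ                 ≡⟨ cong (ε +_) (ℚ.*-identityʳ (fromℕ U)) ⟩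
      ε + fromℕ U                      ∎
      where open ≡-Reasoning

    U<KS₀+j₀ε : fromℕ U < KS 0 + fromℕ j₀ * ε
    U<KS₀+j₀ε = begin-strict
      fromℕ U              ≡⟨ sym (ℚ.+-identityˡ (fromℕ U)) ⟩
      0ℚ + fromℕ U         <⟨ ℚ.+-monoˡ-< (fromℕ U) ε>0 ⟩
      ε + fromℕ U          ≡⟨ sym (ℚ.+-identityˡ (ε + fromℕ U)) ⟩
      0ℚ + (ε + fromℕ U)   ≤⟨ +-monoˡ-≤ _ KS₀≥0 ⟩
      KS 0 + (ε + fromℕ U) ≡⟨ cong (KS 0 +_) (sym j₀ε≡ε+U) ⟩
      KS 0 + fromℕ j₀ * ε  ∎
      where open ℚ.≤-Reasoning

module FiniteSubsets where

  open import Data.Bool using (Bool; true; false; not)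
  open import Data.Vec using (Vec; []; _∷_; lookup; tabulate)
  open import Data.Fin using (Fin; fromℕ<)
  import Data.Fin as Fin
  open import Data.Fin.Subset using (Subset; ∣_∣)
  open import Data.Nat.Solver using (module +-*-Solver)
  open +-*-Solver using (solve; _:=_; _:+_)
  open ≡-Reasoning

  -- Subsets of Fin n read as predicates on ℕ that are false from n on.
  member : ∀ {n} → Subset n → ℕ → Bool
  member []       j       = false
  member (x ∷ xs) zero    = x
  member (x ∷ xs) (suc j) = member xs j

  lookup≡member : ∀ {n} (E : Subset n) j (j<n : j ℕ.< n) → lookup E (fromℕ< j<n) ≡ member E j
  lookup≡member (x ∷ E) zero    j<n        = refl
  lookup≡member (x ∷ E) (suc j) (ℕ.s≤s j<n) = lookup≡member E j j<n

  member-tabulate : ∀ {n} (g : Fin n → Bool) j (j<n : j ℕ.< n) → member (tabulate g) j ≡ g (fromℕ< j<n)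
  member-tabulate {suc n} g zero    j<n        = refl
  member-tabulate {suc n} g (suc j) (ℕ.s≤s j<n) = member-tabulate (λ i → g (Fin.suc i)) j j<n

  member-ext : ∀ {n} (E F : Subset n) → (∀ j → j ℕ.< n → member E j ≡ member F j) → E ≡ F
  member-ext []      []      _   = refl
  member-ext (x ∷ E) (y ∷ F) E≗F = cong₂ _∷_ (E≗F 0 ℕ.z<s) (member-ext E F (λ j j<n → E≗F (suc j) (ℕ.s≤s j<n)))

  toℕ : Bool → ℕ
  toℕ true  = 1
  toℕ false = 0

  toℕ≤1 : ∀ x → toℕ x ℕ.≤ 1
  toℕ≤1 true  = ℕ.s≤s ℕ.z≤n
  toℕ≤1 false = ℕ.z≤n

  count : (ℕ → Bool) → ℕ → ℕ
  count X zero    = 0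
  count X (suc n) = count X n ℕ.+ toℕ (X n)

  count-suc : ∀ X n → count X (suc n) ≡ toℕ (X 0) ℕ.+ count (λ j → X (suc j)) n
  count-suc X zero    = ℕ.+-comm 0 (toℕ (X 0))
  count-suc X (suc n) = trans (cong (ℕ._+ toℕ (X (suc n))) (count-suc X n)) (ℕ.+-assoc (toℕ (X 0)) _ _)

  ∣E∣≡count : ∀ {n} (E : Subset n) → ∣ E ∣ ≡ count (member E) n
  ∣E∣≡count []               = refl
  ∣E∣≡count {suc n} (true ∷ E)  = trans (cong suc (∣E∣≡count E)) (sym (count-suc (member (true ∷ E)) n))
  ∣E∣≡count {suc n} (false ∷ E) = trans (∣E∣≡count E) (sym (count-suc (member (false ∷ E)) n))

  count-not+count : ∀ X n → count (λ j → not (X j)) n ℕ.+ count X n ≡ n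
  count-not+count X zero    = refl
  count-not+count X (suc n) = begin
    (A ℕ.+ toℕ (not (X n))) ℕ.+ (C ℕ.+ toℕ (X n))  ≡⟨ solve 4 (λ a x c y → (a :+ x) :+ (c :+ y) := (a :+ c) :+ (x :+ y))
                                                         refl A (toℕ (not (X n))) C (toℕ (X n)) ⟩
    (A ℕ.+ C) ℕ.+ (toℕ (not (X n)) ℕ.+ toℕ (X n))  ≡⟨ cong₂ ℕ._+_ (count-not+count X n) (not+id (X n)) ⟩
    n ℕ.+ 1                                        ≡⟨ ℕ.+-comm n 1 ⟩
    suc n                                          ∎
    where
    A = count (λ j → not (X j)) n
    C = count X n
    not+id : ∀ x → toℕ (not x) ℕ.+ toℕ x ≡ 1
    not+id true  = refl
    not+id false = refl

module DivMod where

  open import Data.Nat.DivMod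
  open import Data.Nat.Divisibility using (divides-refl)
  open import Data.Product using (_×_; _,_)

  [r+kd]%d≡r : ∀ r k d .{{_ : ℕ.NonZero d}} → r ℕ.< d → (r ℕ.+ k ℕ.* d) % d ≡ r
  [r+kd]%d≡r r k d r<d = trans ([m+kn]%n≡m%n r k d) (m<n⇒m%n≡m r<d)

  [r+kd]/d≡k : ∀ r k d .{{_ : ℕ.NonZero d}} → r ℕ.< d → (r ℕ.+ k ℕ.* d) / d ≡ k
  [r+kd]/d≡k r k d r<d = trans (+-distrib-/-∣ʳ r (divides-refl k)) (cong₂ ℕ._+_ (m<n⇒m/n≡0 r<d) (m*n/n≡m k d))

  r+kd-injective : ∀ {r r′ k k′} d .{{_ : ℕ.NonZero d}} → r ℕ.< d → r′ ℕ.< d →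
                   r ℕ.+ k ℕ.* d ≡ r′ ℕ.+ k′ ℕ.* d → r ≡ r′ × k ≡ k′
  r+kd-injective {r} {r′} {k} {k′} d r<d r′<d eq =
    trans (sym ([r+kd]%d≡r r k d r<d)) (trans (cong (_% d) eq) ([r+kd]%d≡r r′ k′ d r′<d)) ,
    trans (sym ([r+kd]/d≡k r k d r<d)) (trans (cong (_/ d) eq) ([r+kd]/d≡k r′ k′ d r′<d))

module BaseDigits (c : ℕ) where

  open import Data.Nat.DivMod using (_%_; _/_; m%n<n; m/n<m; m≡m%n+[m/n]*n)
  open import Data.Empty using (⊥-elim)
  open import Data.Bool using (Bool; true; _∧_; _∨_; not)
  open import Data.Bool.Properties using (∨-∧-booleanAlgebra)
  open import Algebra.Lattice.Properties.BooleanAlgebra ∨-∧-booleanAlgebra using (deMorgan₂)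
  open import Data.Vec using (lookup)
  open import Data.Fin using (fromℕ<)
  open import Data.Fin.Subset using (Subset)
  open import Data.Product using (_×_; _,_; proj₂)
  open FiniteSubsets using (member; lookup≡member)
  open DivMod

  b : ℕ
  b = suc (suc c)

  1<b : 1 ℕ.< b
  1<b = ℕ.s≤s (ℕ.s≤s ℕ.z≤n)

  m/b<m : ∀ m → 1 ℕ.≤ m → m / b ℕ.< m
  m/b<m (suc k) _ = m/n<m (suc k) b 1<b

  m%b≡0⇒m≡[m/b]*b : ∀ m → m % b ≡ 0 → m ≡ m / b ℕ.* b
  m%b≡0⇒m≡[m/b]*b m m%b≡0 = trans (m≡m%n+[m/n]*n m b) (cong (ℕ._+ m / b ℕ.* b) m%b≡0)

  m%b≡0⇒1≤m/b : ∀ m → 1 ℕ.≤ m → m % b ≡ 0 → 1 ℕ.≤ m / b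
  m%b≡0⇒1≤m/b m 1≤m m%b≡0 with m / b in m/b≡
  ... | suc _ = ℕ.s≤s ℕ.z≤n
  ... | zero  = ⊥-elim (ℕ.<-irrefl refl (ℕ.≤-trans 1≤m (ℕ.≤-reflexive
                  (trans (m%b≡0⇒m≡[m/b]*b m m%b≡0) (cong (ℕ._* b) m/b≡)))))

  hasDigitIn-fuel : ∀ E f₁ f₂ m → m ℕ.≤ f₁ → m ℕ.≤ f₂ → hasDigitIn b E f₁ m ≡ hasDigitIn b E f₂ m
  hasDigitIn-fuel E zero     zero     m       _          _          = refl
  hasDigitIn-fuel E zero     (suc f₂) zero    _          _          = refl
  hasDigitIn-fuel E (suc f₁) zero     zero    _          _          = refl
  hasDigitIn-fuel E (suc f₁) (suc f₂) zero    _          _          = refl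
  hasDigitIn-fuel E (suc f₁) (suc f₂) (suc k) (ℕ.s≤s k≤f₁) (ℕ.s≤s k≤f₂) =
    cong (lookup E (fromℕ< (m%n<n (suc k) b)) ∨_)
      (hasDigitIn-fuel E f₁ f₂ (suc k / b) (quotient≤ k≤f₁) (quotient≤ k≤f₂))
    where
    quotient≤ : ∀ {f} → k ℕ.≤ f → suc k / b ℕ.≤ f
    quotient≤ = ℕ.≤-trans (ℕ.<⇒≤pred (m/b<m (suc k) (ℕ.s≤s ℕ.z≤n)))

  avoids-unfold : ∀ E m → 1 ℕ.≤ m → avoids b E m ≡ not (member E (m % b)) ∧ avoids b E (m / b)
  avoids-unfold E (suc k) _ =
    trans (deMorgan₂ (lookup E (fromℕ< (m%n<n (suc k) b))) (hasDigitIn b E k (suc k / b)))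
      (cong₂ (λ x y → not x ∧ not y)
        (lookup≡member E (suc k % b) (m%n<n (suc k) b))
        (hasDigitIn-fuel E k (suc k / b) (suc k / b) (ℕ.<⇒≤pred (m/b<m (suc k) (ℕ.s≤s ℕ.z≤n))) ℕ.≤-refl))

  private
    ∧-split : ∀ {x y} → x ∧ y ≡ true → x ≡ true × y ≡ true
    ∧-split {true} {true} _ = refl , refl

  avoids⇒digit×quotient : ∀ E m → 1 ℕ.≤ m → avoids b E m ≡ true →
                          not (member E (m % b)) ≡ true × avoids b E (m / b) ≡ true
  avoids⇒digit×quotient E m 1≤m av = ∧-split (trans (sym (avoids-unfold E m 1≤m)) av)

  avoids-r+kb : ∀ E r k → r ℕ.< b → 1 ℕ.≤ r ℕ.+ k ℕ.* b →
                avoids b E (r ℕ.+ k ℕ.* b) ≡ not (member E r) ∧ avoids b E k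
  avoids-r+kb E r k r<b pos = trans (avoids-unfold E (r ℕ.+ k ℕ.* b) pos)
    (cong₂ (λ x y → not (member E x) ∧ avoids b E y) ([r+kd]%d≡r r k b r<b) ([r+kd]/d≡k r k b r<b))

  avoids-r+kb⇒avoids-k : ∀ E r k → r ℕ.< b → 1 ℕ.≤ r ℕ.+ k ℕ.* b →
                         avoids b E (r ℕ.+ k ℕ.* b) ≡ true → avoids b E k ≡ true
  avoids-r+kb⇒avoids-k E r k r<b pos av = proj₂ (∧-split (trans (sym (avoids-r+kb E r k r<b pos)) av))

module Rank (allowed : ℕ → Bool) where

  open import Data.Bool using (true; false)
  open import Data.Product using (_×_; _,_; Σ-syntax)
  open import Data.Sum using (_⊎_; inj₁; inj₂)
  open import Data.Empty using (⊥-elim)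
  open import Relation.Binary using (tri<; tri≈; tri>)
  open FiniteSubsets using (toℕ; toℕ≤1; count)

  rank : ℕ → ℕ
  rank zero    = 0
  rank (suc d) = rank d ℕ.+ toℕ (allowed (suc d))

  rank-count : ∀ d → toℕ (allowed 0) ℕ.+ rank d ≡ count allowed (suc d)
  rank-count zero    = ℕ.+-comm (toℕ (allowed 0)) 0
  rank-count (suc d) = trans (sym (ℕ.+-assoc (toℕ (allowed 0)) (rank d) _)) (cong (ℕ._+ toℕ (allowed (suc d))) (rank-count d))

  rank≤ : ∀ d → rank d ℕ.≤ d
  rank≤ zero    = ℕ.z≤n
  rank≤ (suc d) = subst (rank (suc d) ℕ.≤_) (ℕ.+-comm d 1) (ℕ.+-mono-≤ (rank≤ d) (toℕ≤1 _))

  rank-mono : ∀ {d d′} → d ℕ.≤ d′ → rank d ℕ.≤ rank d′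
  rank-mono {d} {zero}   ℕ.z≤n = ℕ.z≤n
  rank-mono {d} {suc d′} d≤1+d′ with ℕ.m≤n⇒m<n∨m≡n d≤1+d′
  ... | inj₁ (ℕ.s≤s d≤d′) = ℕ.≤-trans (rank-mono d≤d′) (ℕ.m≤m+n (rank d′) _)
  ... | inj₂ refl        = ℕ.≤-refl

  rank-strict : ∀ {d d′} → d ℕ.< d′ → allowed d′ ≡ true → rank d ℕ.< rank d′
  rank-strict {d} {suc d′} (ℕ.s≤s d≤d′) allowed-d′ rewrite allowed-d′ =
    subst (suc (rank d) ℕ.≤_) (ℕ.+-comm 1 (rank d′)) (ℕ.s≤s (rank-mono d≤d′))

  rank-injective : ∀ {d d′} → allowed d ≡ true → allowed d′ ≡ true → rank d ≡ rank d′ → d ≡ d′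
  rank-injective {d} {d′} allowed-d allowed-d′ eq with ℕ.<-cmp d d′
  ... | tri< d<d′ _ _ = ⊥-elim (ℕ.<-irrefl eq (rank-strict d<d′ allowed-d′))
  ... | tri≈ _ d≡d′ _ = d≡d′
  ... | tri> _ _ d>d′ = ⊥-elim (ℕ.<-irrefl (sym eq) (rank-strict d>d′ allowed-d))

  rank≡id⇒allowed : ∀ d → rank d ≡ d → ∀ i → 1 ℕ.≤ i → i ℕ.≤ d → allowed i ≡ true
  rank≡id⇒allowed zero    _     (suc i) _ ()
  rank≡id⇒allowed (suc d) rank≡ i 1≤i i≤1+d with allowed (suc d) in allowed-1+d
  ... | false = ⊥-elim (ℕ.<-irrefl refl (subst (ℕ._≤ d) (trans (sym (ℕ.+-identityʳ (rank d))) rank≡) (rank≤ d)))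
  ... | true with ℕ.m≤n⇒m<n∨m≡n i≤1+d
  ...   | inj₂ refl        = allowed-1+d
  ...   | inj₁ (ℕ.s≤s i≤d) = rank≡id⇒allowed d (ℕ.suc-injective (trans (ℕ.+-comm 1 (rank d)) rank≡)) i 1≤i i≤d

  allowed-between-or-rank≡ : ∀ {x y} → x ℕ.≤ y →
    (Σ[ d ∈ ℕ ] (x ℕ.< d × d ℕ.≤ y × allowed d ≡ true)) ⊎ rank y ≡ rank x
  allowed-between-or-rank≡ {x} {zero}  ℕ.z≤n = inj₂ refl
  allowed-between-or-rank≡ {x} {suc y} x≤1+y with ℕ.m≤n⇒m<n∨m≡n x≤1+y
  ... | inj₂ refl = inj₂ refl
  ... | inj₁ (ℕ.s≤s x≤y) with allowed (suc y) in allowed-1+y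
  ...   | true  = inj₁ (suc y , ℕ.s≤s x≤y , ℕ.≤-refl , allowed-1+y)
  ...   | false with allowed-between-or-rank≡ x≤y
  ...     | inj₁ (d , x<d , d≤y , allowed-d) = inj₁ (d , x<d , ℕ.m≤n⇒m≤1+n d≤y , allowed-d)
  ...     | inj₂ rank≡                     = inj₂ (trans (ℕ.+-identityʳ (rank y)) rank≡)

-- rebase n: write n in bijective base q (digits 1, …, q) and read the digit string in base b.
-- Since q < b, this enumerates the numbers all of whose base-b digits lie in {1, …, q}, in increasing order.
module BijectiveBase (c q′ : ℕ) (q<b : suc q′ ℕ.< suc (suc c)) where

  open import Data.Nat.DivMod using (_%_; _/_; m%n<n; m/n≤m; m≡m%n+[m/n]*n)
  open import Data.Nat.Induction using (<-rec)
  open import Data.Sum using (inj₁; inj₂)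
  open import Data.Empty using (⊥-elim)
  open import Relation.Binary using (tri<; tri≈; tri>)
  open DivMod

  b q : ℕ
  b = suc (suc c)
  q = suc q′

  rebaseWithFuel : ℕ → ℕ → ℕ
  rebaseWithFuel zero    n       = 0
  rebaseWithFuel (suc f) zero    = 0
  rebaseWithFuel (suc f) (suc n) = suc (n % q) ℕ.+ rebaseWithFuel f (n / q) ℕ.* b

  rebase : ℕ → ℕ
  rebase n = rebaseWithFuel n n

  rebaseWithFuel-fuel : ∀ f₁ f₂ n → n ℕ.≤ f₁ → n ℕ.≤ f₂ → rebaseWithFuel f₁ n ≡ rebaseWithFuel f₂ n
  rebaseWithFuel-fuel zero     zero     n       _          _          = refl
  rebaseWithFuel-fuel zero     (suc f₂) zero    _          _          = refl
  rebaseWithFuel-fuel (suc f₁) zero     zero    _          _          = refl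
  rebaseWithFuel-fuel (suc f₁) (suc f₂) zero    _          _          = refl
  rebaseWithFuel-fuel (suc f₁) (suc f₂) (suc n) (ℕ.s≤s n≤f₁) (ℕ.s≤s n≤f₂) =
    cong (λ x → suc (n % q) ℕ.+ x ℕ.* b)
      (rebaseWithFuel-fuel f₁ f₂ (n / q) (ℕ.≤-trans (m/n≤m n q) n≤f₁) (ℕ.≤-trans (m/n≤m n q) n≤f₂))

  rebase-suc : ∀ n → rebase (suc n) ≡ suc (n % q) ℕ.+ rebase (n / q) ℕ.* b
  rebase-suc n = cong (λ x → suc (n % q) ℕ.+ x ℕ.* b)
    (rebaseWithFuel-fuel n (n / q) (n / q) (m/n≤m n q) ℕ.≤-refl)

  rebase-digit : ∀ e k → e ℕ.< q → rebase (suc (e ℕ.+ k ℕ.* q)) ≡ suc e ℕ.+ rebase k ℕ.* b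
  rebase-digit e k e<q = trans (rebase-suc (e ℕ.+ k ℕ.* q))
    (cong₂ (λ x y → suc x ℕ.+ rebase y ℕ.* b) ([r+kd]%d≡r e k q e<q) ([r+kd]/d≡k e k q e<q))

  rebase-small : ∀ e → e ℕ.< q → rebase (suc e) ≡ suc e
  rebase-small e e<q = begin
    rebase (suc e)                   ≡⟨ cong (λ x → rebase (suc x)) (sym (ℕ.+-identityʳ e)) ⟩
    rebase (suc (e ℕ.+ 0 ℕ.* q))     ≡⟨ rebase-digit e 0 e<q ⟩
    suc e ℕ.+ 0                      ≡⟨ ℕ.+-identityʳ (suc e) ⟩
    suc e                            ∎
    where open ≡-Reasoning

  -- Incrementing the lowest bijective digit q wraps to 1 with a carry, which costs at least b - q ≥ 1.
  rebase-< : ∀ n → rebase n ℕ.< rebase (suc n)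
  rebase-< = <-rec (λ n → rebase n ℕ.< rebase (suc n)) step
    where
    step : ∀ n → (∀ {k} → k ℕ.< n → rebase k ℕ.< rebase (suc k)) → rebase n ℕ.< rebase (suc n)
    step zero    _  = subst (0 ℕ.<_) (sym (rebase-suc 0)) ℕ.z<s
    step (suc n) IH = begin-strict
      rebase (suc n)                   ≡⟨ cong (λ x → rebase (suc x)) (m≡m%n+[m/n]*n n q) ⟩
      rebase (suc (e ℕ.+ k ℕ.* q))     ≡⟨ rebase-digit e k e<q ⟩
      suc e ℕ.+ rebase k ℕ.* b         <⟨ next ⟩
      rebase (suc (suc n))             ∎
      where
      open ℕ.≤-Reasoning
      e = n % q
      k = n / q
      e<q = m%n<n n q
      next : suc e ℕ.+ rebase k ℕ.* b ℕ.< rebase (suc (suc n))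
      next with ℕ.m≤n⇒m<n∨m≡n e<q
      ... | inj₁ 1+e<q = begin-strict
        suc e ℕ.+ rebase k ℕ.* b             <⟨ ℕ.n<1+n _ ⟩
        suc (suc e) ℕ.+ rebase k ℕ.* b       ≡⟨ rebase-digit (suc e) k 1+e<q ⟨
        rebase (suc (suc (e ℕ.+ k ℕ.* q)))   ≡⟨ cong (λ x → rebase (suc (suc x))) (m≡m%n+[m/n]*n n q) ⟨
        rebase (suc (suc n))                 ∎
      ... | inj₂ 1+e≡q = begin-strict
        suc e ℕ.+ rebase k ℕ.* b             ≤⟨ ℕ.+-monoˡ-≤ (rebase k ℕ.* b) (ℕ.≤-trans e<q (ℕ.<⇒≤ q<b)) ⟩
        b ℕ.+ rebase k ℕ.* b                 ≤⟨ ℕ.*-monoˡ-≤ b (IH (ℕ.s≤s (m/n≤m n q))) ⟩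
        rebase (suc k) ℕ.* b                 <⟨ ℕ.n<1+n _ ⟩
        suc (0 ℕ.+ rebase (suc k) ℕ.* b)     ≡⟨ rebase-digit 0 (suc k) ℕ.z<s ⟨
        rebase (suc (0 ℕ.+ suc k ℕ.* q))     ≡⟨ cong (λ x → rebase (suc x)) n+1≡[k+1]q ⟨
        rebase (suc (suc n))                 ∎
        where
        n+1≡[k+1]q : suc n ≡ 0 ℕ.+ suc k ℕ.* q
        n+1≡[k+1]q = trans (cong suc (m≡m%n+[m/n]*n n q)) (cong (ℕ._+ k ℕ.* q) 1+e≡q)

  rebase-strictMono : ∀ {m n} → m ℕ.< n → rebase m ℕ.< rebase n
  rebase-strictMono {m} {suc n} (ℕ.s≤s m≤n) with ℕ.m≤n⇒m<n∨m≡n m≤n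
  ... | inj₁ m<n = ℕ.<-trans (rebase-strictMono m<n) (rebase-< n)
  ... | inj₂ refl = rebase-< m

  rebase-injective : ∀ {m n} → rebase m ≡ rebase n → m ≡ n
  rebase-injective {m} {n} eq with ℕ.<-cmp m n
  ... | tri< m<n _ _ = ⊥-elim (ℕ.<-irrefl eq (rebase-strictMono m<n))
  ... | tri≈ _ m≡n _ = m≡n
  ... | tri> _ _ m>n = ⊥-elim (ℕ.<-irrefl (sym eq) (rebase-strictMono m>n))

  rebase-multiple< : ∀ j → rebase (suc j ℕ.* q) ℕ.< rebase (suc j) ℕ.* b
  rebase-multiple< j = begin-strict
    rebase (suc (q′ ℕ.+ j ℕ.* q))   ≡⟨ rebase-digit q′ j ℕ.≤-refl ⟩
    q ℕ.+ rebase j ℕ.* b            <⟨ ℕ.+-monoˡ-< (rebase j ℕ.* b) q<b ⟩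
    b ℕ.+ rebase j ℕ.* b            ≤⟨ ℕ.*-monoˡ-≤ b (rebase-< j) ⟩
    rebase (suc j) ℕ.* b            ∎
    where open ℕ.≤-Reasoning

  rebase[n*q]≤ : ∀ n {k} → rebase n ℕ.≤ k → rebase (n ℕ.* q) ℕ.≤ k ℕ.* b
  rebase[n*q]≤ zero    _           = ℕ.z≤n
  rebase[n*q]≤ (suc j) rebase≤k = ℕ.<⇒≤ (ℕ.<-≤-trans (rebase-multiple< j) (ℕ.*-monoˡ-≤ b rebase≤k))

  rebase[n*q]< : ∀ n {k} → 1 ℕ.≤ n → rebase n ℕ.≤ k → rebase (n ℕ.* q) ℕ.< k ℕ.* b
  rebase[n*q]< (suc j) _ rebase≤k = ℕ.<-≤-trans (rebase-multiple< j) (ℕ.*-monoˡ-≤ b rebase≤k)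

-- If 0 is allowed, the ranks of allowed digits are 0, …, q - 1
-- and encode m is an ordinary base-q numeral; otherwise they are 1, …, q and it is a bijective one.
module Encoding (c q′ : ℕ) (q<b : suc q′ ℕ.< suc (suc c)) (E : Subset (suc (suc c)))
  (count-allowed : FiniteSubsets.count (λ j → not (FiniteSubsets.member E j)) (suc (suc c)) ≡ suc q′)
  where

  open import Data.Nat.DivMod using (_%_; _/_; m%n<n; m≡m%n+[m/n]*n; m<n⇒m%n≡m; m<n⇒m/n≡0)
  open import Data.Nat.Induction using (<-rec)
  open import Data.Bool using (true; _∧_; not)
  open import Data.Product using (_×_; _,_; Σ-syntax)
  open import Data.Empty using (⊥; ⊥-elim)
  open FiniteSubsets using (member; toℕ)
  open DivMod
  open BaseDigits c
  open BijectiveBase c q′ q<b using (q; rebase; rebase-digit; rebase-small; rebase-injective; rebase[n*q]≤; rebase[n*q]<)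

  allowed : ℕ → Bool
  allowed j = not (member E j)

  open Rank allowed public

  z : ℕ
  z = toℕ (allowed 0)

  1≤rank+z : ∀ d → allowed d ≡ true → 1 ℕ.≤ rank d ℕ.+ z
  1≤rank+z zero    allowed-0 rewrite allowed-0 = ℕ.s≤s ℕ.z≤n
  1≤rank+z (suc d) allowed-d = ℕ.≤-trans (rank-strict ℕ.z<s allowed-d) (ℕ.m≤m+n _ z)

  rank+z≤q : ∀ d → d ℕ.< b → rank d ℕ.+ z ℕ.≤ q
  rank+z≤q d d<b = begin
    rank d ℕ.+ z           ≤⟨ ℕ.+-monoˡ-≤ z (rank-mono (ℕ.<⇒≤pred d<b)) ⟩
    rank (suc c) ℕ.+ z     ≡⟨ ℕ.+-comm (rank (suc c)) z ⟩
    z ℕ.+ rank (suc c)     ≡⟨ rank-count (suc c) ⟩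
    _                      ≡⟨ count-allowed ⟩
    q                      ∎
    where open ℕ.≤-Reasoning

  rank≤q : ∀ d → d ℕ.< b → rank d ℕ.≤ q
  rank≤q d d<b = ℕ.≤-trans (ℕ.m≤m+n (rank d) z) (rank+z≤q d d<b)

  -- Shifting by z makes the last digit of m recoverable from (encode m + z) mod q, see encode+z≡.
  digitValue : ∀ d → d ℕ.< b → allowed d ≡ true → Σ[ r ∈ ℕ ] (rank d ℕ.+ z ≡ suc r × r ℕ.< q)
  digitValue d d<b allowed-d with rank d ℕ.+ z | 1≤rank+z d allowed-d | rank+z≤q d d<b
  ... | suc r | _ | r<q = r , refl , r<q

  rank≡0⇒≡0 : ∀ {d} → allowed d ≡ true → rank d ≡ 0 → d ≡ 0
  rank≡0⇒≡0 {zero}  _         _      = refl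
  rank≡0⇒≡0 {suc d} allowed-d rank≡0 = ⊥-elim (ℕ.<-irrefl (sym rank≡0) (rank-strict ℕ.z<s allowed-d))

  Avoids : ℕ → Set
  Avoids m = avoids b E m ≡ true

  avoids-split : ∀ m → 1 ℕ.≤ m → Avoids m → allowed (m % b) ≡ true × Avoids (m / b)
  avoids-split = avoids⇒digit×quotient E

  encodeWithFuel : ℕ → ℕ → ℕ
  encodeWithFuel zero    m       = 0
  encodeWithFuel (suc f) zero    = 0
  encodeWithFuel (suc f) (suc k) = rank (suc k % b) ℕ.+ encodeWithFuel f (suc k / b) ℕ.* q

  encode : ℕ → ℕ
  encode m = encodeWithFuel m m

  encodeWithFuel-fuel : ∀ f₁ f₂ m → m ℕ.≤ f₁ → m ℕ.≤ f₂ → encodeWithFuel f₁ m ≡ encodeWithFuel f₂ m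
  encodeWithFuel-fuel zero     zero     m       _          _          = refl
  encodeWithFuel-fuel zero     (suc f₂) zero    _          _          = refl
  encodeWithFuel-fuel (suc f₁) zero     zero    _          _          = refl
  encodeWithFuel-fuel (suc f₁) (suc f₂) zero    _          _          = refl
  encodeWithFuel-fuel (suc f₁) (suc f₂) (suc k) (ℕ.s≤s k≤f₁) (ℕ.s≤s k≤f₂) =
    cong (λ x → rank (suc k % b) ℕ.+ x ℕ.* q)
      (encodeWithFuel-fuel f₁ f₂ (suc k / b) (quotient≤ k≤f₁) (quotient≤ k≤f₂))
    where
    quotient≤ : ∀ {f} → k ℕ.≤ f → suc k / b ℕ.≤ f
    quotient≤ = ℕ.≤-trans (ℕ.<⇒≤pred (m/b<m (suc k) ℕ.z<s))

  encode-unfold : ∀ m → 1 ℕ.≤ m → encode m ≡ rank (m % b) ℕ.+ encode (m / b) ℕ.* q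
  encode-unfold (suc k) _ = cong (λ x → rank (suc k % b) ℕ.+ x ℕ.* q)
    (encodeWithFuel-fuel k (suc k / b) (suc k / b) (ℕ.<⇒≤pred (m/b<m (suc k) ℕ.z<s)) ℕ.≤-refl)

  encode-pos : ∀ m → 1 ℕ.≤ m → Avoids m → 1 ℕ.≤ encode m
  encode-pos = <-rec (λ m → 1 ℕ.≤ m → Avoids m → 1 ℕ.≤ encode m) step
    where
    step : ∀ m → (∀ {k} → k ℕ.< m → 1 ℕ.≤ k → Avoids k → 1 ℕ.≤ encode k) → 1 ℕ.≤ m → Avoids m → 1 ℕ.≤ encode m
    step m IH 1≤m av rewrite encode-unfold m 1≤m with m % b in m%b≡ | avoids-split m 1≤m av
    ... | suc d | allowed-d , _   = ℕ.≤-trans (rank-strict ℕ.z<s allowed-d) (ℕ.m≤m+n _ _)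
    ... | zero  | _ , avoids-m/b = ℕ.≤-trans (IH (m/b<m m 1≤m) (m%b≡0⇒1≤m/b m 1≤m m%b≡) avoids-m/b)
                                             (ℕ.m≤m*n (encode (m / b)) q)

  encode+z≡ : ∀ m → 1 ℕ.≤ m → Avoids m → Σ[ r ∈ ℕ ] (r ℕ.< q × encode m ℕ.+ z ≡ suc (r ℕ.+ encode (m / b) ℕ.* q)
                                                          × rank (m % b) ℕ.+ z ≡ suc r)
  encode+z≡ m 1≤m av with digitValue (m % b) (m%n<n m b) (Data.Product.proj₁ (avoids-split m 1≤m av))
  ... | r , rank+z≡ , r<q = r , r<q , eq , rank+z≡
    where
    open ≡-Reasoning
    eq : encode m ℕ.+ z ≡ suc (r ℕ.+ encode (m / b) ℕ.* q)
    eq = begin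
      encode m ℕ.+ z                                 ≡⟨ cong (ℕ._+ z) (encode-unfold m 1≤m) ⟩
      rank (m % b) ℕ.+ encode (m / b) ℕ.* q ℕ.+ z    ≡⟨ ℕ.+-assoc (rank (m % b)) _ z ⟩
      rank (m % b) ℕ.+ (encode (m / b) ℕ.* q ℕ.+ z)  ≡⟨ cong (rank (m % b) ℕ.+_) (ℕ.+-comm _ z) ⟩
      rank (m % b) ℕ.+ (z ℕ.+ encode (m / b) ℕ.* q)  ≡⟨ ℕ.+-assoc (rank (m % b)) z _ ⟨
      rank (m % b) ℕ.+ z ℕ.+ encode (m / b) ℕ.* q    ≡⟨ cong (ℕ._+ encode (m / b) ℕ.* q) rank+z≡ ⟩
      suc (r ℕ.+ encode (m / b) ℕ.* q)               ∎

  encode-injective : ∀ m m′ → Avoids m → Avoids m′ → encode m ≡ encode m′ → m ≡ m′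
  encode-injective = <-rec (λ m → ∀ m′ → Avoids m → Avoids m′ → encode m ≡ encode m′ → m ≡ m′) step
    where
    step : ∀ m → (∀ {k} → k ℕ.< m → ∀ k′ → Avoids k → Avoids k′ → encode k ≡ encode k′ → k ≡ k′) →
           ∀ m′ → Avoids m → Avoids m′ → encode m ≡ encode m′ → m ≡ m′
    step zero    IH zero     _  _   _  = refl
    step zero    IH (suc m′) _  av′ eq = ⊥-elim (ℕ.<-irrefl eq (encode-pos (suc m′) ℕ.z<s av′))
    step (suc m) IH zero     av _   eq = ⊥-elim (ℕ.<-irrefl (sym eq) (encode-pos (suc m) ℕ.z<s av))
    step (suc m) IH (suc m′) av av′ eq
      with encode+z≡ (suc m) ℕ.z<s av | encode+z≡ (suc m′) ℕ.z<s av′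
    ... | r , r<q , e+z≡ , rank+z≡ | r′ , r′<q , e′+z≡ , rank′+z≡ = begin
        suc m                                  ≡⟨ m≡m%n+[m/n]*n (suc m) b ⟩
        suc m % b ℕ.+ suc m / b ℕ.* b          ≡⟨ cong₂ (λ x y → x ℕ.+ y ℕ.* b) same-digit same-rest ⟩
        suc m′ % b ℕ.+ suc m′ / b ℕ.* b        ≡⟨ m≡m%n+[m/n]*n (suc m′) b ⟨
        suc m′                                 ∎
      where
      open ≡-Reasoning
      split = r+kd-injective q r<q r′<q
                (ℕ.suc-injective (trans (sym e+z≡) (trans (cong (ℕ._+ z) eq) e′+z≡)))
      same-digit : suc m % b ≡ suc m′ % b
      same-digit = rank-injective (Data.Product.proj₁ (avoids-split (suc m) ℕ.z<s av))
                     (Data.Product.proj₁ (avoids-split (suc m′) ℕ.z<s av′))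
                     (ℕ.+-cancelʳ-≡ z _ _ (trans rank+z≡ (trans (cong suc (Data.Product.proj₁ split)) (sym rank′+z≡))))
      same-rest : suc m / b ≡ suc m′ / b
      same-rest = IH (m/b<m (suc m) ℕ.z<s) (suc m′ / b)
                    (Data.Product.proj₂ (avoids-split (suc m) ℕ.z<s av))
                    (Data.Product.proj₂ (avoids-split (suc m′) ℕ.z<s av′)) (Data.Product.proj₂ split)

  shrink : ℕ → ℕ
  shrink m = rebase (encode m)

  shrink-injective : ∀ {m m′} → Avoids m → Avoids m′ → shrink m ≡ shrink m′ → m ≡ m′
  shrink-injective av av′ eq = encode-injective _ _ av av′ (rebase-injective eq)

  private
    shrink-lastDigit0 : ∀ m → 1 ℕ.≤ m → m % b ≡ 0 → shrink m ≡ rebase (encode (m / b) ℕ.* q)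
    shrink-lastDigit0 m 1≤m m%b≡0 = cong rebase (trans (encode-unfold m 1≤m) (cong (λ d → rank d ℕ.+ encode (m / b) ℕ.* q) m%b≡0))

  shrink-≤ : ∀ m → Avoids m → shrink m ℕ.≤ m
  shrink-≤ = <-rec (λ m → Avoids m → shrink m ℕ.≤ m) step
    where
    step : ∀ m → (∀ {k} → k ℕ.< m → Avoids k → shrink k ℕ.≤ k) → Avoids m → shrink m ℕ.≤ m
    step zero    _  _  = ℕ.z≤n
    step (suc n) IH av = positive (suc n) ℕ.z<s IH av
      where
      positive : ∀ m → 1 ℕ.≤ m → (∀ {k} → k ℕ.< m → Avoids k → shrink k ℕ.≤ k) → Avoids m → shrink m ℕ.≤ m
      positive m 1≤m IH av with avoids-split m 1≤m av
      ... | allowed-d , avoids-k with rank (m % b) in rank-d≡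
      ...   | suc e = begin
              shrink m                              ≡⟨ cong rebase (trans (encode-unfold m 1≤m) (cong (ℕ._+ encode k ℕ.* q) rank-d≡)) ⟩
              rebase (suc e ℕ.+ encode k ℕ.* q)     ≡⟨ rebase-digit e (encode k) e<q ⟩
              suc e ℕ.+ shrink k ℕ.* b              ≤⟨ ℕ.+-mono-≤ (subst (ℕ._≤ m % b) rank-d≡ (rank≤ (m % b)))
                                                                   (ℕ.*-monoˡ-≤ b (IH (m/b<m m 1≤m) avoids-k)) ⟩
              m % b ℕ.+ k ℕ.* b                     ≡⟨ m≡m%n+[m/n]*n m b ⟨
              m                                     ∎
        where
        open ℕ.≤-Reasoning
        k = m / b
        e<q : e ℕ.< q
        e<q = subst (ℕ._≤ q) rank-d≡ (rank≤q (m % b) (m%n<n m b))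
      ...   | zero = begin
              shrink m                          ≡⟨ shrink-lastDigit0 m 1≤m m%b≡0 ⟩
              rebase (encode (m / b) ℕ.* q)     ≤⟨ rebase[n*q]≤ (encode (m / b)) (IH (m/b<m m 1≤m) avoids-k) ⟩
              m / b ℕ.* b                       ≡⟨ m%b≡0⇒m≡[m/b]*b m m%b≡0 ⟨
              m                                 ∎
        where
        open ℕ.≤-Reasoning
        m%b≡0 = rank≡0⇒≡0 allowed-d rank-d≡

  shrink-< : ∀ m → 1 ℕ.≤ m → Avoids m → m % b ≡ 0 → shrink m ℕ.< m
  shrink-< m 1≤m av m%b≡0 with avoids-split m 1≤m av
  ... | _ , avoids-k = begin-strict
    shrink m                          ≡⟨ shrink-lastDigit0 m 1≤m m%b≡0 ⟩
    rebase (encode (m / b) ℕ.* q)     <⟨ rebase[n*q]< (encode (m / b)) (encode-pos (m / b) 1≤k avoids-k)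
                                                      (shrink-≤ (m / b) avoids-k) ⟩
    m / b ℕ.* b                       ≡⟨ m%b≡0⇒m≡[m/b]*b m m%b≡0 ⟨
    m                                 ∎
    where
    open ℕ.≤-Reasoning
    1≤k = m%b≡0⇒1≤m/b m 1≤m m%b≡0

  avoids-digit : ∀ d → 1 ℕ.≤ d → d ℕ.< b → allowed d ≡ true → Avoids d
  avoids-digit d 1≤d d<b allowed-d = begin
    avoids b E d                   ≡⟨ cong (avoids b E) (ℕ.+-identityʳ d) ⟨
    avoids b E (d ℕ.+ 0 ℕ.* b)     ≡⟨ avoids-r+kb E d 0 d<b (ℕ.≤-trans 1≤d (ℕ.m≤m+n d 0)) ⟩
    allowed d ∧ true               ≡⟨ cong (_∧ true) allowed-d ⟩
    true                           ∎
    where open ≡-Reasoning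

  shrink-digit : ∀ d → 1 ℕ.≤ d → d ℕ.< b → allowed d ≡ true → shrink d ≡ rank d
  shrink-digit d 1≤d d<b allowed-d = begin
    rebase (encode d)                                  ≡⟨ cong rebase (encode-unfold d 1≤d) ⟩
    rebase (rank (d % b) ℕ.+ encode (d / b) ℕ.* q)     ≡⟨ cong₂ (λ x y → rebase (rank x ℕ.+ encode y ℕ.* q))
                                                            (m<n⇒m%n≡m d<b) (m<n⇒m/n≡0 d<b) ⟩
    rebase (rank d ℕ.+ 0)                              ≡⟨ cong rebase (ℕ.+-identityʳ (rank d)) ⟩
    rebase (rank d)                                    ≡⟨ rebase-rank ⟩
    rank d                                             ∎
    where
    open ≡-Reasoning
    rebase-rank : rebase (rank d) ≡ rank d
    rebase-rank with rank d | rank-strict {0} 1≤d allowed-d | rank≤q d d<b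
    ... | suc e | _ | e<q = rebase-small e e<q

  no-positive-avoider : rank (suc c) ≡ 0 → ∀ m → 1 ℕ.≤ m → Avoids m → ⊥
  no-positive-avoider no-nonzero-allowed = <-rec (λ m → 1 ℕ.≤ m → Avoids m → ⊥) step
    where
    step : ∀ m → (∀ {k} → k ℕ.< m → 1 ℕ.≤ k → Avoids k → ⊥) → 1 ℕ.≤ m → Avoids m → ⊥
    step m IH 1≤m av with m % b in m%b≡ | avoids-split m 1≤m av | m%n<n m b
    ... | zero  | _ , avoids-k  | _   = IH (m/b<m m 1≤m) (m%b≡0⇒1≤m/b m 1≤m m%b≡) avoids-k
    ... | suc d | allowed-d , _ | d<b = ℕ.<-irrefl (sym no-nonzero-allowed)
          (ℕ.<-≤-trans (rank-strict ℕ.z<s allowed-d) (rank-mono (ℕ.≤-pred d<b)))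

module Special (c q′ p : ℕ) (1≤p : 1 ℕ.≤ p) (q+p≡b : suc q′ ℕ.+ p ≡ suc (suc c)) where

  open import Data.Nat.DivMod using (_%_; _/_; m%n<n; m/n≤m)
  open import Data.Nat.Induction using (<-rec)
  open import Data.Bool using (true; false; _∨_; _∧_; not)
  open import Data.Fin using (toℕ)
  open import Data.Fin.Properties using (toℕ-fromℕ<)
  open import Data.Empty using (⊥-elim)
  open import Relation.Nullary using (yes; no)
  open import Relation.Nullary.Decidable using (⌊_⌋)
  open FiniteSubsets using (member; member-tabulate)
  open BaseDigits c

  q : ℕ
  q = suc q′

  q<b : q ℕ.< b
  q<b = subst (q ℕ.<_) q+p≡b (subst (ℕ._≤ q ℕ.+ p) (ℕ.+-comm q 1) (ℕ.+-monoʳ-≤ q 1≤p))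

  S : Subset b
  S = special b p

  member-S : ∀ j → j ℕ.< b → member S j ≡ (⌊ j ℕ.≟ 0 ⌋ ∨ ⌊ b ℕ.<? j ℕ.+ p ⌋)
  member-S j j<b = trans (member-tabulate (λ i → ⌊ toℕ i ℕ.≟ 0 ⌋ ∨ ⌊ b ℕ.<? toℕ i ℕ.+ p ⌋) j j<b)
                         (cong (λ x → ⌊ x ℕ.≟ 0 ⌋ ∨ ⌊ b ℕ.<? x ℕ.+ p ⌋) (toℕ-fromℕ< j<b))

  0∈S : member S 0 ≡ true
  0∈S = member-S 0 ℕ.z<s

  1…q∉S : ∀ e → 1 ℕ.≤ e → e ℕ.≤ q → member S e ≡ false
  1…q∉S (suc e) _ e<q = trans (member-S (suc e) (ℕ.≤-<-trans e<q q<b)) lemma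
    where
    lemma : (⌊ suc e ℕ.≟ 0 ⌋ ∨ ⌊ b ℕ.<? suc e ℕ.+ p ⌋) ≡ false
    lemma with b ℕ.<? suc e ℕ.+ p
    ... | yes b<e+p = ⊥-elim (ℕ.<-irrefl refl
                        (ℕ.<-≤-trans b<e+p (ℕ.≤-trans (ℕ.+-monoˡ-≤ p e<q) (ℕ.≤-reflexive q+p≡b))))
    ... | no _ = refl

  q+1…b-1∈S : ∀ e → q ℕ.< e → e ℕ.< b → member S e ≡ true
  q+1…b-1∈S (suc e) q<e e<b = trans (member-S (suc e) e<b) lemma
    where
    lemma : (⌊ suc e ℕ.≟ 0 ⌋ ∨ ⌊ b ℕ.<? suc e ℕ.+ p ⌋) ≡ true
    lemma with b ℕ.<? suc e ℕ.+ p
    ... | yes _ = refl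
    ... | no b≮e+p = ⊥-elim (b≮e+p (subst (ℕ._< suc e ℕ.+ p) q+p≡b (ℕ.+-monoˡ-< p q<e)))

  open BijectiveBase c q′ q<b using (rebase; rebase-suc)

  rebase-avoids-S : ∀ n → avoids b S (rebase n) ≡ true
  rebase-avoids-S = <-rec (λ n → avoids b S (rebase n) ≡ true) step
    where
    step : ∀ n → (∀ {k} → k ℕ.< n → avoids b S (rebase k) ≡ true) → avoids b S (rebase n) ≡ true
    step zero    _  = refl
    step (suc n) IH = begin
      avoids b S (rebase (suc n))                              ≡⟨ cong (avoids b S) (rebase-suc n) ⟩
      avoids b S (suc e ℕ.+ rebase (n / q) ℕ.* b)              ≡⟨ avoids-r+kb S (suc e) (rebase (n / q)) e+1<b ℕ.z<s ⟩
      not (member S (suc e)) ∧ avoids b S (rebase (n / q))     ≡⟨ cong₂ (λ x y → not x ∧ y)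
                                                                    (1…q∉S (suc e) ℕ.z<s (m%n<n n q))
                                                                    (IH (ℕ.s≤s (m/n≤m n q))) ⟩
      true                                                     ∎
      where
      open ≡-Reasoning
      e = n % q
      e+1<b : suc e ℕ.< b
      e+1<b = ℕ.<-≤-trans (ℕ.s≤s (m%n<n n q)) q<b

module KempnerSums where

  open import Data.Rational using (0ℚ; _≤_; _+_)
  open import Data.Bool using (false)
  open Reciprocals
  open FiniteSums

  K≡sumBelow : ∀ b E N → K b E N ≡ sumBelow (restrict (avoids b E) recip) (suc N)
  K≡sumBelow b E zero    = sym (trans (ℚ.+-identityˡ _) (restrict-recip-0 (avoids b E)))
    where
    restrict-recip-0 : ∀ X → restrict X recip 0 ≡ 0ℚ
    restrict-recip-0 X with X 0
    ... | true  = refl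
    ... | false = refl
  K≡sumBelow b E (suc N) = cong (_+ restrict (avoids b E) recip (suc N)) (K≡sumBelow b E N)

  K-mono : ∀ b E {M M′} → M ℕ.≤ M′ → K b E M ≤ K b E M′
  K-mono b E {M} {M′} M≤M′ = subst₂ _≤_ (sym (K≡sumBelow b E M)) (sym (K≡sumBelow b E M′))
    (sumBelow-monoʳ (restrict-nonNeg recip recip-nonNeg (avoids b E)) (ℕ.s≤s M≤M′))

-- When 0 ∈ E, the block of m with m / b = k ≥ 1 contributes at most (b - 1)/(kb) = ((b - 1)/b)·(1/k),
-- so b·T(kb) ≤ b² + (b - 1)·T(k) for the partial sums T, and hence T(kb) ≤ b².
module UpperBound (c : ℕ) (E : Subset (suc (suc c))) (0∈E : FiniteSubsets.member E 0 ≡ true) where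

  open import Data.Rational using (ℚ; 0ℚ; 1ℚ; _≤_; _+_; _*_)
  open import Data.Rational.Properties using (≤-trans; +-mono-≤; +-monoʳ-≤; +-identityʳ)
  open import Data.Bool using (true; false)
  open import Data.Rational.Solver using (module +-*-Solver)
  open +-*-Solver using (solve; _:=_; _:+_; _:*_; con)
  open Reciprocals
  open FiniteSums
  open KempnerSums
  open BaseDigits c

  h : ℕ → ℚ
  h = restrict (avoids b E) recip

  T : ℕ → ℚ
  T = sumBelow h

  h-nonNeg : ∀ m → 0ℚ ≤ h m
  h-nonNeg = restrict-nonNeg recip recip-nonNeg (avoids b E)

  H : ℕ → ℚ
  H = restrict (avoids b E) (λ k → recip (k ℕ.* b))

  b*H≡h : ∀ k → fromℕ b * H k ≡ h k
  b*H≡h k with avoids b E k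
  ... | true  = trans (cong (λ v → fromℕ b * recip v) (ℕ.*-comm k b)) (fromℕ*recip[*]≡recip (suc c) k)
  ... | false = ℚ.*-zeroʳ (fromℕ b)

  h[kb]≡0 : ∀ k → 1 ℕ.≤ k → h (0 ℕ.+ k ℕ.* b) ≡ 0ℚ
  h[kb]≡0 (suc k) _ rewrite avoids-r+kb E 0 (suc k) ℕ.z<s ℕ.z<s | 0∈E = refl

  h[e+1+kb]≤H : ∀ k e → 1 ℕ.≤ k → e ℕ.< suc c → h (suc e ℕ.+ k ℕ.* b) ≤ H k
  h[e+1+kb]≤H (suc k) e _ e<1+c with avoids b E (suc e ℕ.+ suc k ℕ.* b) in avoids-m
  ... | false = restrict-nonNeg (λ k → recip (k ℕ.* b)) (λ k → recip-nonNeg (k ℕ.* b)) (avoids b E) (suc k)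
  ... | true rewrite avoids-r+kb⇒avoids-k E (suc e) (suc k) (ℕ.s≤s e<1+c) ℕ.z<s avoids-m =
        recip-antimono (ℕ.≤-trans (ℕ.n≤1+n _) (ℕ.m≤n+m _ e))

  block≤ : ∀ k → 1 ℕ.≤ k → sumBelow (λ e → h (e ℕ.+ k ℕ.* b)) b ≤ fromℕ (suc c) * H k
  block≤ k 1≤k = subst₂ _≤_ (sym (sumBelow-suc (λ e → h (e ℕ.+ k ℕ.* b)) (suc c)))
    (trans (ℚ.+-identityˡ _) (sumBelow-const (H k) (suc c)))
    (+-mono-≤ (ℚ.≤-reflexive (h[kb]≡0 k 1≤k)) (sumBelow-mono (suc c) (λ e e<1+c → h[e+1+kb]≤H k e 1≤k e<1+c)))

  C : ℚ
  C = fromℕ b * fromℕ b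

  T[kb]≤ : ∀ k → fromℕ b * T (k ℕ.* b) ≤ C + fromℕ (suc c) * T k
  T[kb]≤ zero = begin
    fromℕ b * 0ℚ                ≡⟨ ℚ.*-zeroʳ (fromℕ b) ⟩
    0ℚ                          ≡⟨ ℚ.*-zeroʳ (fromℕ b) ⟨
    fromℕ b * 0ℚ                ≤⟨ *-monoˡ-≤-nonNeg (fromℕ b) (fromℕ-nonNeg b) (fromℕ-nonNeg b) ⟩
    C                           ≡⟨ +-identityʳ C ⟨
    C + 0ℚ                      ≡⟨ cong (λ v → C + v) (ℚ.*-zeroʳ (fromℕ (suc c))) ⟨
    C + fromℕ (suc c) * 0ℚ      ∎
    where open ℚ.≤-Reasoning
  T[kb]≤ (suc zero) = begin
    fromℕ b * T (1 ℕ.* b)       ≡⟨ cong (λ n → fromℕ b * T n) (ℕ.*-identityˡ b) ⟩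
    fromℕ b * T b               ≤⟨ *-monoˡ-≤-nonNeg (fromℕ b) (fromℕ-nonNeg b)
                                     (sumBelow≤fromℕ (λ m → ≤-trans (restrict-≤ recip recip-nonNeg (avoids b E) m) (recip≤1 m)) b) ⟩
    C                           ≤⟨ p≤p+q C 0≤ ⟩
    C + fromℕ (suc c) * T 1     ∎
    where
    open ℚ.≤-Reasoning
    0≤ : 0ℚ ≤ fromℕ (suc c) * T 1
    0≤ = subst (_≤ fromℕ (suc c) * T 1) (ℚ.*-zeroʳ (fromℕ (suc c)))
           (*-monoˡ-≤-nonNeg (fromℕ (suc c)) (fromℕ-nonNeg (suc c)) (sumBelow-nonNeg h-nonNeg 1))
  T[kb]≤ (suc k₁@(suc _)) = begin
    fromℕ b * T (b ℕ.+ k₁ ℕ.* b)                             ≡⟨ cong (λ v → fromℕ b * v) (sumBelow-+ h b (k₁ ℕ.* b)) ⟩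
    fromℕ b * (T (k₁ ℕ.* b) + block)                         ≡⟨ ℚ.*-distribˡ-+ (fromℕ b) (T (k₁ ℕ.* b)) block ⟩
    fromℕ b * T (k₁ ℕ.* b) + fromℕ b * block                 ≤⟨ +-mono-≤ (T[kb]≤ k₁) b*block≤ ⟩
    (C + fromℕ (suc c) * T k₁) + fromℕ (suc c) * h k₁        ≡⟨ solve 4 (λ a x t u → (a :+ x :* t) :+ x :* u := a :+ x :* (t :+ u))
                                                                  refl C (fromℕ (suc c)) (T k₁) (h k₁) ⟩
    C + fromℕ (suc c) * T (suc k₁)                           ∎
    where
    open ℚ.≤-Reasoning
    block = sumBelow (λ e → h (e ℕ.+ k₁ ℕ.* b)) b
    b*block≤ : fromℕ b * block ≤ fromℕ (suc c) * h k₁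
    b*block≤ = begin
      fromℕ b * block                        ≤⟨ *-monoˡ-≤-nonNeg (fromℕ b) (fromℕ-nonNeg b) (block≤ k₁ ℕ.z<s) ⟩
      fromℕ b * (fromℕ (suc c) * H k₁)       ≡⟨ solve 3 (λ x y z → x :* (y :* z) := y :* (x :* z)) refl (fromℕ b) (fromℕ (suc c)) (H k₁) ⟩
      fromℕ (suc c) * (fromℕ b * H k₁)       ≡⟨ cong (λ v → fromℕ (suc c) * v) (b*H≡h k₁) ⟩
      fromℕ (suc c) * h k₁                   ∎

  K-bounded : ∀ M → K b E M ≤ fromℕ (b ℕ.* b)
  K-bounded M = subst₂ _≤_ (sym (K≡sumBelow b E M)) (sym (fromℕ-* b b))
    (≤-trans (sumBelow-monoʳ h-nonNeg (ℕ.m≤m*n (suc M) b)) X≤C)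
    where
    X = T (suc M ℕ.* b)
    X+[b-1]X≤C+[b-1]X : X + fromℕ (suc c) * X ≤ C + fromℕ (suc c) * X
    X+[b-1]X≤C+[b-1]X = begin
      X + fromℕ (suc c) * X          ≡⟨ solve 2 (λ x y → y :+ x :* y := (con 1ℚ :+ x) :* y) refl (fromℕ (suc c)) X ⟩
      (1ℚ + fromℕ (suc c)) * X       ≡⟨ cong (_* X) (fromℕ-suc (suc c)) ⟨
      fromℕ b * X                    ≤⟨ T[kb]≤ (suc M) ⟩
      C + fromℕ (suc c) * T (suc M)  ≤⟨ +-monoʳ-≤ C (*-monoˡ-≤-nonNeg (fromℕ (suc c)) (fromℕ-nonNeg (suc c))
                                          (sumBelow-monoʳ h-nonNeg (ℕ.m≤m*n (suc M) b))) ⟩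
      C + fromℕ (suc c) * X          ∎
      where open ℚ.≤-Reasoning
    X≤C : X ≤ C
    X≤C = +-cancelʳ-≤ X C (fromℕ (suc c) * X) X+[b-1]X≤C+[b-1]X

module Comparison (c q′ p : ℕ) (1≤p : 1 ℕ.≤ p) (q+p≡b : suc q′ ℕ.+ p ≡ suc (suc c))
                  (E : Subset (suc (suc c))) (∣E∣≡p : ∣ E ∣ ≡ p) where

  open import Data.Rational using (_≤_; _+_)
  open import Data.Rational.Properties using (≤-refl; ≤-trans)
  open import Data.Bool using (false; _∧_)
  open import Data.Bool.Properties using (not-involutive)
  open import Data.Product using (Σ-syntax; _,_)
  open import Data.Sum using (_⊎_; inj₁; inj₂)
  open import Data.Empty using (⊥-elim)
  open import Relation.Nullary using (¬_; yes; no)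
  open Reciprocals
  open FiniteSums
  open FiniteSubsets using (member; member-ext; count; count-not+count; ∣E∣≡count)
  open Suprema
  open KempnerSums
  open DivMod
  open BaseDigits c
  open Special c q′ p 1≤p q+p≡b using (q; q<b; S; 0∈S; 1…q∉S; q+1…b-1∈S; rebase-avoids-S)
  open BijectiveBase c q′ q<b using (rebase-strictMono)

  count-allowed : count (λ j → not (member E j)) b ≡ q
  count-allowed = ℕ.+-cancelʳ-≡ p _ _ (begin
    count (λ j → not (member E j)) b ℕ.+ p                    ≡⟨ cong (_ ℕ.+_) (trans (sym ∣E∣≡p) (∣E∣≡count E)) ⟩
    count (λ j → not (member E j)) b ℕ.+ count (member E) b   ≡⟨ count-not+count (member E) b ⟩
    b                                                         ≡⟨ q+p≡b ⟨
    q ℕ.+ p                                                   ∎)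
    where open ≡-Reasoning

  open Encoding c q′ q<b E count-allowed

  recip≤recip∘shrink : ∀ m → restrict (avoids b E) recip m ≤ restrict (avoids b E) (λ m → recip (shrink m)) m
  recip≤recip∘shrink m with avoids b E m in av
  ... | false = ≤-refl
  ... | true with m
  ...   | zero   = recip-nonNeg (shrink 0)
  ...   | suc m′ with shrink (suc m′) in shrink≡ | encode-pos (suc m′) ℕ.z<s av | shrink-≤ (suc m′) av
  ...     | suc a | 1≤encode | ℕ.s≤s a≤m′ = recip-antimono a≤m′
  ...     | zero  | 1≤encode | _ = ⊥-elim (ℕ.<-irrefl (sym shrink≡) (rebase-strictMono 1≤encode))

  sum-recip∘shrink≤ : ∀ N → sumBelow (restrict (avoids b E) (λ m → recip (shrink m))) N
                                ≤ sumBelow (restrict (avoids b S) recip) N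
  sum-recip∘shrink≤ N = sumBelow-reindex-≤ recip recip-nonNeg (avoids b E) shrink shrink-≤
    (λ m m′ av av′ → shrink-injective av av′) N (avoids b S) (λ m _ _ → rebase-avoids-S (encode m))

  K-E≤K-S : ∀ M → K b E M ≤ K b S M
  K-E≤K-S M = subst₂ _≤_ (sym (K≡sumBelow b E M)) (sym (K≡sumBelow b S M))
    (≤-trans (sumBelow-mono (suc M) (λ m _ → recip≤recip∘shrink m)) (sum-recip∘shrink≤ (suc M)))

  Gap : Set
  Gap = Σ[ n ∈ ℕ ] Σ[ m₀ ∈ ℕ ] (∀ M → m₀ ℕ.≤ M → K b E M + recip (suc n) ≤ K b S M)

  gap-of-shrinking-point : ∀ m₀ → 1 ℕ.≤ m₀ → Avoids m₀ → shrink m₀ ℕ.< m₀ → Gap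
  gap-of-shrinking-point (suc m′) _ av shrink< with shrink (suc m′) in shrink≡ | encode-pos (suc m′) ℕ.z<s av
  ... | zero  | 1≤encode = ⊥-elim (ℕ.<-irrefl (sym shrink≡) (rebase-strictMono 1≤encode))
  ... | suc a | _        = m′ ℕ.+ a ℕ.* suc m′ , suc m′ , λ M m₀≤M →
      subst₂ _≤_ (cong (_+ _) (sym (K≡sumBelow b E M))) (sym (K≡sumBelow b S M))
        (≤-trans (sumBelow-strict recip≤recip∘shrink gap (suc M) (ℕ.s≤s m₀≤M)) (sum-recip∘shrink≤ (suc M)))
    where
    gap : restrict (avoids b E) recip (suc m′) + recip (suc a ℕ.* suc m′)
            ≤ restrict (avoids b E) (λ m → recip (shrink m)) (suc m′)
    gap rewrite av | shrink≡ = recip+recip[*]≤recip (ℕ.≤-pred shrink<)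

  gap-of-no-avoider : rank (suc c) ≡ 0 → Gap
  gap-of-no-avoider rank≡0 = 0 , 1 , λ M 1≤M →
    subst₂ _≤_ (cong (_+ recip 1) (sym (K≡sumBelow b E M))) (sym (K≡sumBelow b S M))
      (sumBelow-strict E≤S gap (suc M) (ℕ.s≤s 1≤M))
    where
    E≤S : ∀ m → restrict (avoids b E) recip m ≤ restrict (avoids b S) recip m
    E≤S zero    = ≤-refl
    E≤S (suc m) with avoids b E (suc m) in av
    ... | true  = ⊥-elim (no-positive-avoider rank≡0 (suc m) ℕ.z<s av)
    ... | false = restrict-nonNeg recip recip-nonNeg (avoids b S) (suc m)
    gap : restrict (avoids b E) recip 1 + recip 1 ≤ restrict (avoids b S) recip 1
    gap with avoids b E 1 in av
    ... | true  = ⊥-elim (no-positive-avoider rank≡0 1 ℕ.z<s av)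
    ... | false rewrite rebase-avoids-S 1 = ℚ.≤-reflexive (ℚ.+-identityˡ (recip 1))

  Gap⇒¬SupLe : Gap → ¬ SupLe (K b S) (K b E)
  Gap⇒¬SupLe (n , m₀ , gap) =
    ¬SupLe-of-eventual-gap (K b E) (K b S) (b ℕ.* b) (K-mono b E) (UpperBound.K-bounded c S 0∈S) ≤-refl n m₀ gap

  z+rank≡q : z ℕ.+ rank (suc c) ≡ q
  z+rank≡q = trans (rank-count (suc c)) count-allowed

  gap-if-0∉E : member E 0 ≡ false → Gap
  gap-if-0∉E 0∉E with allowed-between-or-rank≡ {0} {suc c} ℕ.z≤n
  ... | inj₂ rank≡0 = gap-of-no-avoider rank≡0
  ... | inj₁ (d , 1≤d , d≤1+c , allowed-d) =
      gap-of-shrinking-point m₀ 1≤m₀ avoids-m₀ (shrink-< m₀ 1≤m₀ avoids-m₀ ([r+kd]%d≡r 0 d b ℕ.z<s))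
    where
    m₀ = 0 ℕ.+ d ℕ.* b
    1≤m₀ : 1 ℕ.≤ m₀
    1≤m₀ = ℕ.≤-trans 1≤d (ℕ.m≤m*n d b)
    avoids-m₀ : Avoids m₀
    avoids-m₀ = trans (avoids-r+kb E 0 d ℕ.z<s 1≤m₀)
                      (cong₂ _∧_ (cong not 0∉E) (avoids-digit d 1≤d (ℕ.s≤s d≤1+c) allowed-d))

  -- With 0 ∈ E there are q allowed nonzero digits; either one exceeds q, and as a one-digit number it shrinks
  -- to its rank ≤ q, or they are exactly 1, …, q.
  gap-or-E≡S-if-0∈E : member E 0 ≡ true → Gap ⊎ E ≡ S
  gap-or-E≡S-if-0∈E 0∈E with allowed-between-or-rank≡ {q} {suc c} (ℕ.≤-pred q<b)
  ... | inj₁ (d , q<d , d≤1+c , allowed-d) = inj₁ (gap-of-shrinking-point d 1≤d (avoids-digit d 1≤d d<b allowed-d)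
                                                 (subst (ℕ._< d) (sym (shrink-digit d 1≤d d<b allowed-d))
                                                    (ℕ.≤-<-trans (rank≤q d d<b) q<d)))
    where
    1≤d = ℕ.≤-trans ℕ.z<s q<d
    d<b = ℕ.s≤s d≤1+c
  ... | inj₂ rank≡ = inj₂ (member-ext E S same)
    where
    rank[1+c]≡q : rank (suc c) ≡ q
    rank[1+c]≡q = trans (cong (λ x → FiniteSubsets.toℕ (not x) ℕ.+ rank (suc c)) (sym 0∈E)) z+rank≡q
    rank[q]≡q : rank q ≡ q
    rank[q]≡q = trans (sym rank≡) rank[1+c]≡q
    same : ∀ j → j ℕ.< b → member E j ≡ member S j
    same zero    _   = trans 0∈E (sym 0∈S)
    same (suc j) j<b with suc j ℕ.≤? q
    ... | yes j+1≤q = trans (trans (sym (not-involutive _)) (cong not (rank≡id⇒allowed q rank[q]≡q (suc j) ℕ.z<s j+1≤q)))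
                            (sym (1…q∉S (suc j) ℕ.z<s j+1≤q))
    ... | no  j+1≰q = trans (not-allowed (allowed (suc j)) refl) (sym (q+1…b-1∈S (suc j) q<j j<b))
      where
      q<j = ℕ.≰⇒> j+1≰q
      not-allowed : ∀ x → allowed (suc j) ≡ x → member E (suc j) ≡ true
      not-allowed false allowed≡ = trans (sym (not-involutive _)) (cong not allowed≡)
      not-allowed true  allowed≡ = ⊥-elim (ℕ.<-irrefl (trans rank[q]≡q (sym rank[1+c]≡q))
                                     (ℕ.<-≤-trans (rank-strict q<j allowed≡) (rank-mono (ℕ.≤-pred j<b))))

  SupLe⇒E≡S : SupLe (K b S) (K b E) → E ≡ S
  SupLe⇒E≡S sup with member E 0 in E∋0
  ... | false = ⊥-elim (Gap⇒¬SupLe (gap-if-0∉E E∋0) sup)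
  ... | true with gap-or-E≡S-if-0∈E E∋0
  ...   | inj₁ gap = ⊥-elim (Gap⇒¬SupLe gap sup)
  ...   | inj₂ E≡S = E≡S

open import Data.Nat using (_≤_; _<_)
open import Data.Product using (_×_; _,_)

proposition3 : (b p : ℕ) → 2 ≤ b → 1 ≤ p → p < b →
    (E : Subset b) → ∣ E ∣ ≡ p →
    SupLe (K b E) (K b (special b p))
    × (SupLe (K b (special b p)) (K b E) → E ≡ special b p)
proposition3 (suc (suc c)) p (ℕ.s≤s (ℕ.s≤s ℕ.z≤n)) 1≤p p<b E ∣E∣≡p =
  (λ n ε ε>0 → n , ℚ.≤-trans (K-E≤K-S n) (Reciprocals.p≤p+q _ (ℚ.<⇒≤ (ℚ.positive⁻¹ ε {{ε>0}})))) , SupLe⇒E≡S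
  where
  q′ = suc (suc c) ℕ.∸ suc p
  q+p≡b : suc q′ ℕ.+ p ≡ suc (suc c)
  q+p≡b = trans (ℕ.+-comm (suc q′) p) (trans (ℕ.+-suc p q′) (ℕ.m+[n∸m]≡n p<b))
  open Comparison c q′ p 1≤p q+p≡b E ∣E∣≡p
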